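{- Let $p_1=2, p_2=3, p_3=5,\dots$ denote the primes in increasing order. For $k\ge 2$ let $$T^{TP}_k=\frac{\prod_{i=2}^{k-1}(p_i-2)}{\prod_{i=2}^{k}p_i}=\frac{1\cdot 3\cdot 5\cdots (p_{k-1}-2)}{3\cdot 5\cdot 7\cdots p_k}$$ (the empty product equals $1$; so $T^{TP}_2=\tfrac13, T^{TP}_3=\tfrac1{15}, T^{TP}_4=\tfrac{3}{105}, T^{TP}_5=\tfrac{15}{1155},\dots$), and for $n\ge 2$ let $S^{TP}_n=\sum_{k=2}^n T^{TP}_k$. Then $$\lim_{n\to\infty}S^{TP}_n=\frac12.$$ -}

module Defs where

open import Data.Nat as ℕ using (ℕ; zero; suc; _∸_; NonZero)
open import Data.Nat.Properties using (m*n≢0)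
open import Data.Nat.Primality using (Prime; prime⇒nonZero)
open import Data.Integer using (+_)
open import Data.Rational using (ℚ; _/_; _+_; 0ℚ)
open import Data.Product using (_×_; ∃-syntax)
open import Relation.Binary.PropositionalEquality using (_≡_)

-- P is "the primes in increasing order", 0-indexed: P 0 = 2, P 1 = 3, ...
-- The paper's p_i (1-indexed) is P (i ∸ 1).
IsPrimeEnumeration : (ℕ → ℕ) → Set
IsPrimeEnumeration P =
  (∀ i → Prime (P i)) ×
  (∀ i → P i ℕ.< P (suc i)) ×
  (∀ q → Prime q → ∃[ i ] P i ≡ q)

module _ (P : ℕ → ℕ) (pr : ∀ i → Prime (P i)) where

  prodD : ℕ → ℕ
  prodD zero = 1
  prodD (suc m) = prodD m ℕ.* P (suc m)

  prodD-nz : ∀ m → NonZero (prodD m)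
  prodD-nz zero = _
  prodD-nz (suc m) = m*n≢0 (prodD m) (P (suc m))
    {{prodD-nz m}} {{prime⇒nonZero (pr (suc m))}}

  -- prodN m = ∏_{j=1}^{m} (P j ∸ 2)  (= ∏_{i=2}^{m+1} (p_i - 2)); P j ≥ 3 here
  prodN : ℕ → ℕ
  prodN zero = 1
  prodN (suc m) = prodN m ℕ.* (P (suc m) ∸ 2)

  -- T k = ∏_{i=2}^{k-1}(p_i - 2) / ∏_{i=2}^{k} p_i   (meaningful for k ≥ 2)
  T : ℕ → ℚ
  T k = _/_ (+ prodN (k ∸ 2)) (prodD (k ∸ 1)) {{prodD-nz (k ∸ 1)}}

  S : ℕ → ℚ
  S zero = 0ℚ
  S (suc zero) = 0ℚ
  S (suc (suc n)) = S (suc n) + T (suc (suc n))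

module Submission where

-- With g_m = ½ ∏_{i=2}^{m+1} (1 - 2/p_i) we have g_0 = ½ and T_{k+2} + g_{k+1} = g_k, so the partial
-- sums telescope to S_{n+1} = ½ - g_n, and it remains to show g_m → 0. Since 1 - 2/p ≤ 1 - 1/p, this
-- follows from the Mertens-type bound ∏_{i≤m} (1 - 1/p_i) ≤ 2/K for 2^K ≤ m, which is proved in ℕ:
-- expanding the Euler product, the sum of ⌊W/n⌋ over the n ≤ X with all prime factors among
-- p_1, …, p_m is at most W ∏_{i≤m} p_i/(p_i - 1); every n < p_{m+1} is of that kind; and
-- ∑_{n ≤ 2^K} ⌊2^{K+1}/n⌋ ≥ K 2^K.

open import Defs
open import Data.Nat.Base using (ℕ)

module Summation where

  open import Data.Nat.Base using (zero; suc; _+_; _*_; _^_; _≤_; _<_; z≤n; z<s; NonZero)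
  open import Data.Nat.Properties
  open import Data.Nat.DivMod
    using (_/_; _%_; /-congˡ; /-monoʳ-≤; m*n/n≡m; m<n⇒m/n≡0; m/n*n≤m; m/n/o≡m/[n*o];
           m≡m%n+[m/n]*n; m%n<n; m*[n/m]≡n; +-distrib-/-∣ʳ)
  open import Data.Nat.Divisibility using (_∣_; _∣?_; divides; n∣m*n)
  open import Data.Nat.Tactic.RingSolver using (solve-∀)
  open import Data.Sum using (inj₁; inj₂)
  open import Relation.Nullary using (¬_; Dec; yes; no; contradiction)
  open import Relation.Binary.PropositionalEquality

  infixl 7 _÷_

  -- Floor division made total by the junk value W ÷ 0 = 0, so that n ↦ W ÷ n can be summed.
  _÷_ : ℕ → ℕ → ℕ
  W ÷ zero  = 0
  W ÷ suc n = W / suc n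

  ÷-antitone : ∀ W {i j} → 0 < i → i ≤ j → W ÷ j ≤ W ÷ i
  ÷-antitone W {suc i} {suc j} _ i≤j = /-monoʳ-≤ W i≤j

  *÷-cancelʳ : ∀ m {n} → 0 < n → m * n ÷ n ≡ m
  *÷-cancelʳ m {suc n} _ = m*n/n≡m m (suc n)

  ÷-* : ∀ W {p k} → 0 < p → 0 < k → W ÷ (p * k) ≡ W ÷ p ÷ k
  ÷-* W {suc p} {suc k} _ _ = sym (m/n/o≡m/[n*o] W (suc p) (suc k))

  ÷-*-≤ : ∀ W n → W ÷ n * n ≤ W
  ÷-*-≤ W zero    = z≤n
  ÷-*-≤ W (suc n) = m/n*n≤m W (suc n)

  /-suc-∣ : ∀ {p X} .{{_ : NonZero p}} → p ∣ suc X → suc X / p ≡ suc (X / p)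
  /-suc-∣ {suc p′} (divides zero ())
  /-suc-∣ {suc p′} {X} (divides (suc c) eq) = begin
    suc X / p      ≡⟨ /-congˡ eq ⟩
    suc c * p / p  ≡⟨ m*n/n≡m (suc c) p ⟩
    suc c          ≡⟨ cong suc X/p≡c ⟨
    suc (X / p)    ∎
    where
    open ≡-Reasoning
    p = suc p′
    X/p≡c : X / p ≡ c
    X/p≡c = begin
      X / p               ≡⟨ /-congˡ (suc-injective eq) ⟩
      (p′ + c * p) / p    ≡⟨ +-distrib-/-∣ʳ p′ (n∣m*n c) ⟩
      p′ / p + c * p / p  ≡⟨ cong₂ _+_ (m<n⇒m/n≡0 ≤-refl) (m*n/n≡m c p) ⟩
      c                   ∎

  /-suc-∤ : ∀ {p X} .{{_ : NonZero p}} → ¬ p ∣ suc X → suc X / p ≡ X / p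
  /-suc-∤ {p} {X} p∤ with m≤n⇒m<n∨m≡n (m%n<n X p)
  ... | inj₁ 1+r<p = begin
    suc X / p                         ≡⟨ /-congˡ (cong suc (m≡m%n+[m/n]*n X p)) ⟩
    (suc (X % p) + X / p * p) / p     ≡⟨ +-distrib-/-∣ʳ (suc (X % p)) (n∣m*n (X / p)) ⟩
    suc (X % p) / p + X / p * p / p   ≡⟨ cong₂ _+_ (m<n⇒m/n≡0 1+r<p) (m*n/n≡m (X / p) p) ⟩
    X / p                             ∎
    where open ≡-Reasoning
  ... | inj₂ 1+r≡p = contradiction (divides (suc (X / p)) X+1≡[1+q]p) p∤
    where
    X+1≡[1+q]p : suc X ≡ suc (X / p) * p
    X+1≡[1+q]p = trans (cong suc (m≡m%n+[m/n]*n X p)) (cong (_+ X / p * p) 1+r≡p)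

  sumUpTo : (ℕ → ℕ) → ℕ → ℕ
  sumUpTo f zero    = 0
  sumUpTo f (suc X) = sumUpTo f X + f (suc X)

  sumUpTo-mono-≤ : ∀ {f g} X → (∀ {n} → 0 < n → n ≤ X → f n ≤ g n) → sumUpTo f X ≤ sumUpTo g X
  sumUpTo-mono-≤ zero    _   = z≤n
  sumUpTo-mono-≤ (suc X) f≤g =
    +-mono-≤ (sumUpTo-mono-≤ X λ 0<n n≤X → f≤g 0<n (m≤n⇒m≤1+n n≤X)) (f≤g z<s ≤-refl)

  sumUpTo-const : ∀ c X → sumUpTo (λ _ → c) X ≡ X * c
  sumUpTo-const c zero    = refl
  sumUpTo-const c (suc X) = trans (cong (_+ c) (sumUpTo-const c X)) (+-comm (X * c) c)

  sumUpTo-+ : ∀ f a c → sumUpTo f (a + c) ≡ sumUpTo f a + sumUpTo (λ i → f (a + i)) c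
  sumUpTo-+ f a zero    = trans (cong (sumUpTo f) (+-identityʳ a)) (sym (+-identityʳ _))
  sumUpTo-+ f a (suc c) = begin
    sumUpTo f (a + suc c)                                 ≡⟨ cong (sumUpTo f) (+-suc a c) ⟩
    sumUpTo f (a + c) + f (suc (a + c))                   ≡⟨ cong₂ _+_ (sumUpTo-+ f a c) (cong f (sym (+-suc a c))) ⟩
    sumUpTo f a + sumUpTo (λ i → f (a + i)) c + f (a + suc c)
                                                          ≡⟨ +-assoc (sumUpTo f a) _ _ ⟩
    sumUpTo f a + sumUpTo (λ i → f (a + i)) (suc c)       ∎
    where open ≡-Reasoning

  sumUpTo-antitone-≥ : ∀ {f} c → (∀ {i} → 0 < i → i ≤ c → f c ≤ f i) → c * f c ≤ sumUpTo f c
  sumUpTo-antitone-≥ {f} c f-antitone =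
    subst (_≤ sumUpTo f c) (sumUpTo-const (f c) c) (sumUpTo-mono-≤ c f-antitone)

  sumUpTo-split-multiples : ∀ p .{{_ : NonZero p}} {g h : ℕ → ℕ} → (∀ {n} → ¬ p ∣ n → g n ≤ h n) →
    ∀ X → sumUpTo g X ≤ sumUpTo h X + sumUpTo (λ k → g (p * k)) (X / p)
  sumUpTo-split-multiples p g≤h zero = z≤n
  sumUpTo-split-multiples p {g} {h} g≤h (suc X) = step (p ∣? suc X)
    where
    open ≤-Reasoning
    gₚ = λ k → g (p * k)
    H = sumUpTo h X
    M = sumUpTo gₚ (X / p)
    IH : sumUpTo g X ≤ H + M
    IH = sumUpTo-split-multiples p g≤h X
    swap : ∀ a b c → a + b + c ≡ a + c + b
    swap = solve-∀
    step : Dec (p ∣ suc X) → sumUpTo g X + g (suc X) ≤ H + h (suc X) + sumUpTo gₚ (suc X / p)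
    step (yes p∣) = begin
      sumUpTo g X + g (suc X)                ≤⟨ +-monoˡ-≤ (g (suc X)) IH ⟩
      H + M + g (suc X)                      ≡⟨ +-assoc H M (g (suc X)) ⟩
      H + (M + g (suc X))                    ≤⟨ +-monoˡ-≤ (M + g (suc X)) (m≤m+n H (h (suc X))) ⟩
      H + h (suc X) + (M + g (suc X))        ≡⟨ cong (λ n → H + h (suc X) + (M + g n)) (m*[n/m]≡n p∣) ⟨
      H + h (suc X) + (M + gₚ (suc X / p))   ≡⟨ cong (λ n → H + h (suc X) + (M + gₚ n)) (/-suc-∣ p∣) ⟩
      H + h (suc X) + sumUpTo gₚ (suc (X / p)) ≡⟨ cong (λ n → H + h (suc X) + sumUpTo gₚ n) (/-suc-∣ p∣) ⟨
      H + h (suc X) + sumUpTo gₚ (suc X / p) ∎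
    step (no p∤) = begin
      sumUpTo g X + g (suc X)                ≤⟨ +-mono-≤ IH (g≤h p∤) ⟩
      H + M + h (suc X)                      ≡⟨ swap H M (h (suc X)) ⟩
      H + h (suc X) + M                      ≡⟨ cong (λ n → H + h (suc X) + sumUpTo gₚ n) (/-suc-∤ p∤) ⟨
      H + h (suc X) + sumUpTo gₚ (suc X / p) ∎

  harmonic-dyadic : ∀ K → K * 2 ^ K ≤ sumUpTo (2 ^ suc K ÷_) (2 ^ K)
  harmonic-dyadic K =
    subst (λ e → K * 2 ^ e ≤ sumUpTo (2 ^ suc e ÷_) (2 ^ K)) (+-identityʳ K) (blocks K 0)
    where
    blocks : ∀ i j → i * 2 ^ (i + j) ≤ sumUpTo (2 ^ suc (i + j) ÷_) (2 ^ i)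
    blocks zero    j = z≤n
    blocks (suc i) j =
      subst (λ e → suc i * 2 ^ e ≤ sumUpTo (2 ^ suc e ÷_) (2 ^ suc i)) (+-suc i j) (begin
      suc i * 2 ^ e                                   ≡⟨ +-comm (2 ^ e) (i * 2 ^ e) ⟩
      i * 2 ^ e + 2 ^ e                               ≡⟨ cong (i * 2 ^ e +_) 2^e≡a*f[a+a] ⟩
      i * 2 ^ e + a * f (a + a)                       ≤⟨ +-mono-≤ (blocks i (suc j)) (sumUpTo-antitone-≥ a f-antitone) ⟩
      sumUpTo f a + sumUpTo (λ n → f (a + n)) a       ≡⟨ sumUpTo-+ f a a ⟨
      sumUpTo f (a + a)                               ≡⟨ cong (λ n → sumUpTo f (a + n)) (+-identityʳ a) ⟨
      sumUpTo f (2 ^ suc i)                           ∎)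
      where
      open ≤-Reasoning
      e = i + suc j
      a = 2 ^ i
      f = 2 ^ suc e ÷_
      0<a : 0 < a
      0<a = m^n>0 2 i
      f-antitone : ∀ {n} → 0 < n → n ≤ a → f (a + a) ≤ f (a + n)
      f-antitone {n} 0<n n≤a = ÷-antitone (2 ^ suc e) (<-≤-trans 0<n (m≤n+m n a)) (+-monoʳ-≤ a n≤a)
      2^e≡a*f[a+a] : 2 ^ e ≡ a * f (a + a)
      2^e≡a*f[a+a] = begin-equality
        2 ^ e                      ≡⟨ ^-distribˡ-+-* 2 i (suc j) ⟩
        a * 2 ^ suc j              ≡⟨ cong (a *_) (*÷-cancelʳ (2 ^ suc j) (+-mono-< 0<a 0<a)) ⟨
        a * (2 ^ suc j * (a + a) ÷ (a + a)) ≡⟨ cong (λ w → a * (w ÷ (a + a))) 2^[1+j]*[a+a]≡2^[1+e] ⟩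
        a * f (a + a)              ∎
        where
        doubling : ∀ b a → b * (a + a) ≡ 2 * (a * b)
        doubling = solve-∀
        2^[1+j]*[a+a]≡2^[1+e] : 2 ^ suc j * (a + a) ≡ 2 ^ suc e
        2^[1+j]*[a+a]≡2^[1+e] =
          trans (doubling (2 ^ suc j) a) (cong (2 *_) (sym (^-distribˡ-+-* 2 i (suc j))))

module Smoothness where

  open import Data.Nat.Base using (zero; suc; s<s; _*_; _≤_; _<_; NonZero; nonTrivial⇒n>1)
  open import Data.Nat.Properties using (≤-<-trans; <⇒≱; *-comm)
  open import Data.Nat.Divisibility using (_∣_; divides; ∣-trans; ∣⇒≤)
  open import Data.Nat.ListAction using (product)
  open import Data.Nat.Primality using (Prime; prime⇒nonTrivial; prime⇒irreducible; euclidsLemma; ¬prime[1])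
  open import Data.Nat.Primality.Factorisation using (factorise)
  open import Data.List.Base using ([]; _∷_)
  open import Data.List.Relation.Unary.All using (_∷_)
  open import Data.Product using (∃-syntax; _×_; _,_)
  open import Data.Sum using (inj₁; inj₂)
  open import Relation.Nullary using (¬_; contradiction)
  open import Relation.Binary.PropositionalEquality

  prime⇒>1 : ∀ {p} → Prime p → 1 < p
  prime⇒>1 {p} p-prime = nonTrivial⇒n>1 p {{prime⇒nonTrivial p-prime}}

  prime-factor : ∀ n → 1 < n → ∃[ q ] Prime q × q ∣ n
  prime-factor (suc zero) (s<s ())
  prime-factor n@(suc (suc _)) _ with factorise n
  ... | record { factors = [] ; isFactorisation = () }
  ... | record { factors = q ∷ qs ; isFactorisation = n≡q*qs ; factorsPrime = q-prime ∷ _ } =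
    q , q-prime , divides (product qs) (trans n≡q*qs (*-comm q (product qs)))

  infix 10 _Smooth_

  _Smooth_ : ℕ → ℕ → Set
  b Smooth n = ∀ q → Prime q → q ∣ n → q < b

  smooth-< : ∀ {b n} .{{_ : NonZero n}} → n < b → b Smooth n
  smooth-< n<b _ _ q∣n = ≤-<-trans (∣⇒≤ q∣n) n<b

  smooth-∣ : ∀ {b d n} → b Smooth n → d ∣ n → b Smooth d
  smooth-∣ smooth d∣n q q-prime q∣d = smooth q q-prime (∣-trans q∣d d∣n)

  smooth-* : ∀ {b p k} → Prime p → p < b → b Smooth k → b Smooth (p * k)
  smooth-* {p = p} {k} p-prime p<b smooth q q-prime q∣pk with euclidsLemma p k q-prime q∣pk
  ... | inj₂ q∣k = smooth q q-prime q∣k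
  ... | inj₁ q∣p with prime⇒irreducible p-prime q∣p
  ...   | inj₁ refl = contradiction q-prime ¬prime[1]
  ...   | inj₂ refl = p<b

  ¬2-smooth : ∀ {n} → 1 < n → ¬ 2 Smooth n
  ¬2-smooth {n} 1<n smooth with prime-factor n 1<n
  ... | q , q-prime , q∣n = <⇒≱ (smooth q q-prime q∣n) (prime⇒>1 q-prime)

module Enumerated {P : ℕ → ℕ} (hP : IsPrimeEnumeration P) where

  open import Data.Nat.Base using (zero; suc; _+_; _*_; _∸_; _^_; _≤_; _<_; z≤n; s≤s; z<s; NonZero; >-nonZero)
  open import Data.Nat.Properties
  open import Data.Nat.DivMod using (_/_; m/n<m; n/1≡n)
  open import Data.Nat.Divisibility using (_∣_; _∣?_; _∣0; ∣⇒≤; n∣m*n)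
  open import Data.Nat.Induction using (<-rec)
  open import Data.Nat.Primality using (Prime; prime?; prime[2]; prime⇒nonZero)
  open import Data.Nat.Tactic.RingSolver using (solve-∀)
  open import Data.Bool.Base using (if_then_else_)
  open import Data.Product using (∃-syntax; _,_; proj₁; proj₂)
  open import Data.Sum using (inj₁; inj₂)
  open import Function.Bundles using (mk⇔)
  open import Relation.Nullary using (¬_; Dec; yes; no; does; contradiction)
  open import Relation.Nullary.Decidable using (map′; _→-dec_; dec-true; dec-false; does-⇔)
  open import Relation.Binary.Definitions using (tri<; tri≈; tri>)
  open import Relation.Binary.PropositionalEquality
  open Summation
  open Smoothness

  P-prime : ∀ i → Prime (P i)
  P-prime = proj₁ hP

  P-step : ∀ i → P i < P (suc i)
  P-step = proj₁ (proj₂ hP)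

  P-onto : ∀ q → Prime q → ∃[ i ] P i ≡ q
  P-onto = proj₂ (proj₂ hP)

  instance
    P-nonZero : ∀ {i} → NonZero (P i)
    P-nonZero {i} = prime⇒nonZero (P-prime i)

  P>1 : ∀ i → 1 < P i
  P>1 i = prime⇒>1 (P-prime i)

  P-mono-< : ∀ {i j} → i < j → P i < P j
  P-mono-< {i} {suc j} i<1+j with m≤n⇒m<n∨m≡n (m<1+n⇒m≤n i<1+j)
  ... | inj₁ i<j  = <-trans (P-mono-< i<j) (P-step j)
  ... | inj₂ refl = P-step i

  P-cancel-< : ∀ {i j} → P i < P j → i < j
  P-cancel-< {i} {j} Pi<Pj with <-cmp i j
  ... | tri< i<j _ _ = i<j
  ... | tri≈ _ refl _ = contradiction Pi<Pj (<-irrefl refl)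
  ... | tri> _ _ j<i = contradiction Pi<Pj (<-asym (P-mono-< j<i))

  P-zero : P 0 ≡ 2
  P-zero with P-onto 2 prime[2]
  ... | zero  , P0≡2   = P0≡2
  ... | suc i , Pi+1≡2 = contradiction (subst (P 0 <_) Pi+1≡2 (P-mono-< z<s)) (≤⇒≯ (P>1 0))

  n<P : ∀ n → n < P n
  n<P zero    = <-trans z<s (P>1 0)
  n<P (suc n) = <-≤-trans (s≤s (n<P n)) (P-step n)

  smooth-∤ : ∀ {m n} → ¬ P m ∣ n → P (suc m) Smooth n → P m Smooth n
  smooth-∤ {m} P∤n smooth q q-prime q∣n with P-onto q q-prime
  ... | j , refl with m≤n⇒m<n∨m≡n (m<1+n⇒m≤n (P-cancel-< (smooth q q-prime q∣n)))
  ...   | inj₁ j<m  = P-mono-< j<m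
  ...   | inj₂ refl = contradiction q∣n P∤n

  smooth? : ∀ m n → Dec (P m Smooth n)
  smooth? m zero = no λ smooth → <-asym (smooth _ (P-prime (suc m)) (_ ∣0)) (P-step m)
  smooth? m n@(suc _) =
    map′ (λ smooth q q-prime q∣n → smooth (s≤s (∣⇒≤ q∣n)) q-prime q∣n) (λ smooth {q} _ → smooth q)
         (allUpTo? (λ q → prime? q →-dec q ∣? n →-dec q <? P m) (suc n))

  smoothTerm : ℕ → ℕ → ℕ → ℕ
  smoothTerm m W n = if does (smooth? m n) then W ÷ n else 0

  smoothSum : ℕ → ℕ → ℕ → ℕ
  smoothSum m W = sumUpTo (smoothTerm m W)

  smoothTerm-smooth : ∀ {m n} W → P m Smooth n → smoothTerm m W n ≡ W ÷ n
  smoothTerm-smooth {m} {n} W smooth rewrite dec-true (smooth? m n) smooth = refl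

  smoothTerm-¬smooth : ∀ {m n} W → ¬ P m Smooth n → smoothTerm m W n ≡ 0
  smoothTerm-¬smooth {m} {n} W ¬smooth rewrite dec-false (smooth? m n) ¬smooth = refl

  smoothTerm-≤ : ∀ m W n → smoothTerm m W n ≤ W ÷ n
  smoothTerm-≤ m W n with smooth? m n
  ... | yes _ = ≤-refl
  ... | no _  = z≤n

  smoothTerm-mono : ∀ {m m′ n} W → (P m Smooth n → P m′ Smooth n) → smoothTerm m W n ≤ smoothTerm m′ W n
  smoothTerm-mono {m} {m′} {n} W smooth⇒smooth with smooth? m n | smooth? m′ n
  ... | yes _      | yes _       = ≤-refl
  ... | yes smooth | no ¬smooth′ = contradiction (smooth⇒smooth smooth) ¬smooth′
  ... | no _       | _           = z≤n

  smoothTerm-P* : ∀ m W {k} → 0 < k → smoothTerm (suc m) W (P m * k) ≡ smoothTerm (suc m) (W ÷ P m) k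
  smoothTerm-P* m W {k} 0<k =
    cong₂ (λ b w → if b then w else 0)
      (does-⇔ (mk⇔ (λ smooth → smooth-∣ smooth (n∣m*n (P m))) (smooth-* (P-prime m) (P-step m)))
              (smooth? (suc m) (P m * k)) (smooth? (suc m) k))
      (÷-* W (<-trans z<s (P>1 m)) 0<k)

  smoothSum-zero : ∀ W X → smoothSum 0 W X ≤ W
  smoothSum-zero W zero          = z≤n
  smoothSum-zero W (suc zero)    = ≤-trans (smoothTerm-≤ 0 W 1) (≤-reflexive (n/1≡n W))
  smoothSum-zero W (suc (suc X)) = begin
    smoothSum 0 W (suc X) + smoothTerm 0 W (suc (suc X))
      ≡⟨ cong (smoothSum 0 W (suc X) +_) (smoothTerm-¬smooth W ¬smooth) ⟩
    smoothSum 0 W (suc X) + 0                             ≡⟨ +-identityʳ _ ⟩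
    smoothSum 0 W (suc X)                                 ≤⟨ smoothSum-zero W (suc X) ⟩
    W                                                     ∎
    where
    open ≤-Reasoning
    ¬smooth : ¬ P 0 Smooth suc (suc X)
    ¬smooth smooth = ¬2-smooth (s≤s (s≤s z≤n)) (subst (_Smooth suc (suc X)) P-zero smooth)

  primorial : ℕ → ℕ
  primorial zero    = 1
  primorial (suc m) = primorial m * P m

  φprimorial : ℕ → ℕ
  φprimorial zero    = 1
  φprimorial (suc m) = φprimorial m * (P m ∸ 1)

  euler-step : ∀ {A A₁ A₂ W F D} p → 0 < p → A ≤ A₁ + A₂ → A₁ * F ≤ W * D →
    A₂ * (F * (p ∸ 1)) ≤ W ÷ p * (D * p) → A * (F * (p ∸ 1)) ≤ W * (D * p)
  euler-step {A} {A₁} {A₂} {W} {F} {D} (suc q) _ A≤A₁+A₂ A₁-bound A₂-bound = begin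
    A * (F * q)                          ≤⟨ *-monoˡ-≤ (F * q) A≤A₁+A₂ ⟩
    (A₁ + A₂) * (F * q)                  ≡⟨ *-distribʳ-+ (F * q) A₁ A₂ ⟩
    A₁ * (F * q) + A₂ * (F * q)          ≤⟨ +-mono-≤ A₁-bound′ A₂-bound ⟩
    W * D * q + W ÷ suc q * (D * suc q)  ≡⟨ cong (W * D * q +_) (shuffle (W ÷ suc q) D (suc q)) ⟩
    W * D * q + W ÷ suc q * suc q * D    ≤⟨ +-monoʳ-≤ (W * D * q) (*-monoˡ-≤ D (÷-*-≤ W (suc q))) ⟩
    W * D * q + W * D                    ≡⟨ collect W D q ⟩
    W * (D * suc q)                      ∎
    where
    open ≤-Reasoning
    A₁-bound′ : A₁ * (F * q) ≤ W * D * q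
    A₁-bound′ = ≤-trans (≤-reflexive (sym (*-assoc A₁ F q))) (*-monoˡ-≤ q A₁-bound)
    shuffle : ∀ a d p → a * (d * p) ≡ a * p * d
    shuffle = solve-∀
    collect : ∀ w d q → w * d * q + w * d ≡ w * (d * (1 + q))
    collect = solve-∀

  -- A floored form of  Σ_{n P m-smooth} 1/n = ∏_{i<m} P i / (P i - 1).
  smoothSum-bound : ∀ m W X → smoothSum m W X * φprimorial m ≤ W * primorial m
  smoothSum-bound zero W X =
    subst₂ _≤_ (sym (*-identityʳ _)) (sym (*-identityʳ W)) (smoothSum-zero W X)
  smoothSum-bound (suc m) W X = <-rec Bound bound X W
    where
    Bound : ℕ → Set
    Bound X = ∀ W → smoothSum (suc m) W X * φprimorial (suc m) ≤ W * primorial (suc m)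
    bound : ∀ X → (∀ {Y} → Y < X → Bound Y) → Bound X
    bound zero    _   W = z≤n
    bound X@(suc _) rec W =
      euler-step {A₁ = smoothSum m W X} {A₂ = smoothSum (suc m) (W ÷ P m) (X / P m)}
        (P m) (<-trans z<s (P>1 m)) split (smoothSum-bound m W X) (rec (m/n<m X (P m) (P>1 m)) (W ÷ P m))
      where
      split : smoothSum (suc m) W X ≤ smoothSum m W X + smoothSum (suc m) (W ÷ P m) (X / P m)
      split = ≤-trans (sumUpTo-split-multiples (P m) (λ P∤n → smoothTerm-mono W (smooth-∤ P∤n)) X)
        (+-monoʳ-≤ (smoothSum m W X)
          (sumUpTo-mono-≤ (X / P m) λ 0<k _ → ≤-reflexive (smoothTerm-P* m W 0<k)))

  φprimorial-bound : ∀ K {m} → 2 ^ K ≤ m → K * φprimorial m ≤ 2 * primorial m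
  φprimorial-bound K {m} 2^K≤m = *-cancelˡ-≤ (2 ^ K) {{m^n≢0 2 K}} (begin
    2 ^ K * (K * φprimorial m)              ≡⟨ *-comm-middle (2 ^ K) K (φprimorial m) ⟩
    K * 2 ^ K * φprimorial m                ≤⟨ *-monoˡ-≤ (φprimorial m) harmonic≤smooth ⟩
    smoothSum m W (2 ^ K) * φprimorial m    ≤⟨ smoothSum-bound m W (2 ^ K) ⟩
    2 * 2 ^ K * primorial m                 ≡⟨ *-comm-middle (2 ^ K) 2 (primorial m) ⟨
    2 ^ K * (2 * primorial m)               ∎)
    where
    open ≤-Reasoning
    W = 2 ^ suc K
    *-comm-middle : ∀ a b c → a * (b * c) ≡ b * a * c
    *-comm-middle = solve-∀
    harmonic≤smooth : K * 2 ^ K ≤ smoothSum m W (2 ^ K)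
    harmonic≤smooth = ≤-trans (harmonic-dyadic K) (sumUpTo-mono-≤ (2 ^ K) λ {n} 0<n n≤2^K → ≤-reflexive (sym
      (smoothTerm-smooth W (smooth-< {{>-nonZero 0<n}} (≤-<-trans (≤-trans n≤2^K 2^K≤m) (n<P m))))))

  prodN≤φprimorial : ∀ m → prodN P P-prime m ≤ φprimorial (suc m)
  prodN≤φprimorial zero    = ≤-reflexive (cong (λ p → 1 * (p ∸ 1)) (sym P-zero))
  prodN≤φprimorial (suc m) = *-mono-≤ (prodN≤φprimorial m) (∸-monoʳ-≤ (P (suc m)) (s≤s z≤n))

  primorial≡2*prodD : ∀ m → primorial (suc m) ≡ 2 * prodD P P-prime m
  primorial≡2*prodD zero    = cong (1 *_) P-zero
  primorial≡2*prodD (suc m) =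
    trans (cong (_* P (suc m)) (primorial≡2*prodD m)) (*-assoc 2 (prodD P P-prime m) (P (suc m)))

  prodN-decay : ∀ {K m} → 2 ^ K ≤ suc m → K * prodN P P-prime m ≤ 4 * prodD P P-prime m
  prodN-decay {K} {m} 2^K≤1+m = begin
    K * prodN P P-prime m        ≤⟨ *-monoʳ-≤ K (prodN≤φprimorial m) ⟩
    K * φprimorial (suc m)       ≤⟨ φprimorial-bound K 2^K≤1+m ⟩
    2 * primorial (suc m)        ≡⟨ cong (2 *_) (primorial≡2*prodD m) ⟩
    2 * (2 * prodD P P-prime m)  ≡⟨ *-assoc 2 2 (prodD P P-prime m) ⟨
    4 * prodD P P-prime m        ∎
    where open ≤-Reasoning

module Fractions where

  open import Data.Nat.Base as ℕ using (suc; NonZero)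
  open import Data.Nat.Properties using (m*n≢0)
  open import Data.Integer.Base as ℤ using (+_; +<+)
  import Data.Integer.Properties as ℤ
  open import Data.Rational.Base using (_/_; _+_; _<_; toℚᵘ)
  open import Data.Rational.Properties using (toℚᵘ-fromℚᵘ; toℚᵘ-injective; toℚᵘ-cancel-<; toℚᵘ-homo-+)
  open import Data.Rational.Unnormalised.Base as ℚᵘ using (mkℚᵘ; *≡*; *<*; _≃_)
  import Data.Rational.Unnormalised.Properties as ℚᵘ
  open import Relation.Binary.PropositionalEquality

  toℚᵘ-/ : ∀ a b .{{_ : NonZero b}} → toℚᵘ (+ a / b) ≃ + a ℚᵘ./ b
  toℚᵘ-/ a (suc b) = toℚᵘ-fromℚᵘ (mkℚᵘ (+ a) b)

  /ᵘ-cross-≃ : ∀ a b c d .{{_ : NonZero b}} .{{_ : NonZero d}} →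
    a ℕ.* d ≡ c ℕ.* b → + a ℚᵘ./ b ≃ + c ℚᵘ./ d
  /ᵘ-cross-≃ a (suc b) c (suc d) ad≡cb =
    *≡* (trans (sym (ℤ.pos-* a (suc d))) (trans (cong +_ ad≡cb) (ℤ.pos-* c (suc b))))

  /ᵘ-+-/ᵘ : ∀ a b c d .{{_ : NonZero b}} .{{_ : NonZero d}} →
    + a ℚᵘ./ b ℚᵘ.+ + c ℚᵘ./ d ≡ (+ (a ℕ.* d ℕ.+ c ℕ.* b) ℚᵘ./ (b ℕ.* d)) {{m*n≢0 b d}}
  /ᵘ-+-/ᵘ a (suc b) c (suc d) = cong (ℚᵘ._/ (suc b ℕ.* suc d))
    (trans (cong₂ ℤ._+_ (sym (ℤ.pos-* a (suc d))) (sym (ℤ.pos-* c (suc b))))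
           (sym (ℤ.pos-+ (a ℕ.* suc d) (c ℕ.* suc b))))

  a/b+c/d≡e/f : ∀ a b c d e f .{{_ : NonZero b}} .{{_ : NonZero d}} .{{_ : NonZero f}} →
    (a ℕ.* d ℕ.+ c ℕ.* b) ℕ.* f ≡ e ℕ.* (b ℕ.* d) → + a / b + + c / d ≡ + e / f
  a/b+c/d≡e/f a b@(suc _) c d@(suc _) e f eq = toℚᵘ-injective (begin
    toℚᵘ (+ a / b + + c / d)               ≈⟨ toℚᵘ-homo-+ (+ a / b) (+ c / d) ⟩
    toℚᵘ (+ a / b) ℚᵘ.+ toℚᵘ (+ c / d)     ≈⟨ ℚᵘ.+-cong (toℚᵘ-/ a b) (toℚᵘ-/ c d) ⟩
    + a ℚᵘ./ b ℚᵘ.+ + c ℚᵘ./ d             ≡⟨ /ᵘ-+-/ᵘ a b c d ⟩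
    + (a ℕ.* d ℕ.+ c ℕ.* b) ℚᵘ./ (b ℕ.* d) ≈⟨ /ᵘ-cross-≃ _ (b ℕ.* d) e f eq ⟩
    + e ℚᵘ./ f                             ≈⟨ toℚᵘ-/ e f ⟨
    toℚᵘ (+ e / f)                         ∎)
    where open ℚᵘ.≃-Reasoning

  a/b<c/d : ∀ a b c d .{{_ : NonZero b}} .{{_ : NonZero d}} → a ℕ.* d ℕ.< c ℕ.* b → + a / b < + c / d
  a/b<c/d a b@(suc _) c d@(suc _) ad<cb = toℚᵘ-cancel-<
    (ℚᵘ.<-respˡ-≃ (ℚᵘ.≃-sym (toℚᵘ-/ a b)) (ℚᵘ.<-respʳ-≃ (ℚᵘ.≃-sym (toℚᵘ-/ c d))
      (*<* (subst₂ ℤ._<_ (ℤ.pos-* a d) (ℤ.pos-* c b) (+<+ ad<cb)))))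

module Telescoping {P : ℕ → ℕ} (hP : IsPrimeEnumeration P) where

  open import Data.Nat.Base as ℕ using (zero; suc; NonZero; _^_)
  import Data.Nat.Properties as ℕ
  open import Data.Nat.Coprimality using (Coprime)
  open import Data.Nat.Tactic.RingSolver using (solve-∀)
  open import Data.Integer.Base using (+_)
  open import Data.Rational.Base using (ℚ; mkℚ; _/_; _+_; _-_; -_; _<_; ∣_∣; ½; NonNegative)
  open import Data.Rational.Properties
    using (+-assoc; ∣-p∣≡∣p∣; 0≤p⇒∣p∣≡p; nonNegative⁻¹; normalize-nonNeg; normalize-coprime)
  open import Data.Rational.Solver using (module +-*-Solver)
  open import Data.Product using (∃-syntax; _,_)
  open import Relation.Binary.PropositionalEquality
  open Enumerated hP using (P-prime; P>1; prodN-decay)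
  open Fractions

  2*prodD-nonZero : ∀ m → NonZero (2 ℕ.* prodD P P-prime m)
  2*prodD-nonZero m = ℕ.m*n≢0 2 (prodD P P-prime m) {{_}} {{prodD-nz P P-prime m}}

  -- ½ ∏_{j=1}^{m} (1 - 2 / P j)
  gap : ℕ → ℚ
  gap m = (+ prodN P P-prime m / (2 ℕ.* prodD P P-prime m)) {{2*prodD-nonZero m}}

  T+gap≡gap : ∀ k → T P P-prime (suc (suc k)) + gap (suc k) ≡ gap k
  T+gap≡gap k =
    a/b+c/d≡e/f n (d ℕ.* p) (n ℕ.* (p ℕ.∸ 2)) (2 ℕ.* (d ℕ.* p)) n (2 ℕ.* d)
      {{prodD-nz P P-prime (suc k)}} {{2*prodD-nonZero (suc k)}} {{2*prodD-nonZero k}}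
      (subst (λ p′ → (n ℕ.* (2 ℕ.* (d ℕ.* p′)) ℕ.+ n ℕ.* (p ℕ.∸ 2) ℕ.* (d ℕ.* p′)) ℕ.* (2 ℕ.* d)
                     ≡ n ℕ.* (d ℕ.* p′ ℕ.* (2 ℕ.* (d ℕ.* p′))))
             (ℕ.m∸n+n≡m (P>1 (suc k)))
             (cross-multiplied n d (p ℕ.∸ 2)))
    where
    n = prodN P P-prime k
    d = prodD P P-prime k
    p = P (suc k)
    cross-multiplied : ∀ n d r →
      (n ℕ.* (2 ℕ.* (d ℕ.* (r ℕ.+ 2))) ℕ.+ n ℕ.* r ℕ.* (d ℕ.* (r ℕ.+ 2))) ℕ.* (2 ℕ.* d)
      ≡ n ℕ.* (d ℕ.* (r ℕ.+ 2) ℕ.* (2 ℕ.* (d ℕ.* (r ℕ.+ 2))))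
    cross-multiplied = solve-∀

  S+gap≡½ : ∀ n → S P P-prime (suc n) + gap n ≡ ½
  S+gap≡½ zero    = refl
  S+gap≡½ (suc n) = begin
    s + T P P-prime (suc (suc n)) + gap (suc n)    ≡⟨ +-assoc s _ _ ⟩
    s + (T P P-prime (suc (suc n)) + gap (suc n))  ≡⟨ cong (_+_ s) (T+gap≡gap n) ⟩
    s + gap n                                      ≡⟨ S+gap≡½ n ⟩
    ½                                              ∎
    where
    open ≡-Reasoning
    s = S P P-prime (suc n)

  ∣S-½∣≡gap : ∀ n → ∣ S P P-prime (suc n) - ½ ∣ ≡ gap n
  ∣S-½∣≡gap n = begin
    ∣ s - ½ ∣          ≡⟨ cong (λ h → ∣ s - h ∣) (S+gap≡½ n) ⟨
    ∣ s - (s + gap n) ∣ ≡⟨ cong ∣_∣ (x-[x+y]≡-y s (gap n)) ⟩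
    ∣ - gap n ∣         ≡⟨ ∣-p∣≡∣p∣ (gap n) ⟩
    ∣ gap n ∣           ≡⟨ 0≤p⇒∣p∣≡p (nonNegative⁻¹ (gap n) {{gap-nonNeg}}) ⟩
    gap n               ∎
    where
    open ≡-Reasoning
    s = S P P-prime (suc n)
    gap-nonNeg : NonNegative (gap n)
    gap-nonNeg = normalize-nonNeg (prodN P P-prime n) (2 ℕ.* prodD P P-prime n) {{2*prodD-nonZero n}}
    x-[x+y]≡-y : ∀ x y → x - (x + y) ≡ - y
    x-[x+y]≡-y = solve 2 (λ x y → x :- (x :+ y) := :- y) refl
      where open +-*-Solver

  gap-< : ∀ u v {m} → 2 ^ (4 ℕ.* suc v) ℕ.≤ suc m → gap m < + suc u / suc v
  gap-< u v {m} 2^K≤1+m = a/b<c/d n (2 ℕ.* d) (suc u) (suc v) {{2*prodD-nonZero m}} (begin-strict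
    n ℕ.* suc v        ≡⟨ ℕ.*-comm n (suc v) ⟩
    suc v ℕ.* n        ≤⟨ ℕ.*-cancelˡ-≤ 4 4[1+v]n≤4d ⟩
    d                  <⟨ ℕ.m<m*n d 2 {{prodD-nz P P-prime m}} ℕ.≤-refl ⟩
    d ℕ.* 2            ≡⟨ ℕ.*-comm d 2 ⟩
    2 ℕ.* d            ≤⟨ ℕ.m≤n*m (2 ℕ.* d) (suc u) ⟩
    suc u ℕ.* (2 ℕ.* d) ∎)
    where
    open ℕ.≤-Reasoning
    n = prodN P P-prime m
    d = prodD P P-prime m
    4[1+v]n≤4d : 4 ℕ.* (suc v ℕ.* n) ℕ.≤ 4 ℕ.* d
    4[1+v]n≤4d = subst (ℕ._≤ 4 ℕ.* d) (ℕ.*-assoc 4 (suc v) n) (prodN-decay {4 ℕ.* suc v} 2^K≤1+m)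

  S-converges : ∀ u v .(c : Coprime (suc u) (suc v)) →
    ∃[ N ] (∀ n → N ℕ.≤ n → ∣ S P P-prime n - ½ ∣ < mkℚ (+ suc u) v c)
  S-converges u v c = suc (2 ^ (4 ℕ.* suc v)) , close
    where
    close : ∀ n → suc (2 ^ (4 ℕ.* suc v)) ℕ.≤ n → ∣ S P P-prime n - ½ ∣ < mkℚ (+ suc u) v c
    close (suc n) (ℕ.s≤s 2^K≤n) =
      subst₂ _<_ (sym (∣S-½∣≡gap n)) (normalize-coprime c) (gap-< u v (ℕ.m≤n⇒m≤1+n 2^K≤n))


open import Data.Nat using (suc; _≤_)
open import Data.Rational using (ℚ; _<_; _-_; ∣_∣; ½; 0ℚ)
open import Data.Product using (∃-syntax; proj₁)
open import Data.Integer.Base using (+_; -[1+_]; +<+)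
open import Data.Rational.Base using (mkℚ; *<*)

theorem3 : (P : ℕ → ℕ) → (hP : IsPrimeEnumeration P) →
    (ε : ℚ) → 0ℚ < ε →
    ∃[ N ] (∀ n → N ≤ n → ∣ S P (proj₁ hP) n - ½ ∣ < ε)
theorem3 P hP (mkℚ (+ suc u) v c) _            = Telescoping.S-converges hP u v c
theorem3 P hP (mkℚ (+ 0) v c)     (*<* (+<+ ()))
theorem3 P hP (mkℚ -[1+ _ ] v c)  (*<* ())
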